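{- Let $A$ be an infinite set of nonnegative integers, let $d\ge 0$ be an integer and let $\lambda_0,\dots,\lambda_d$ be integers with $\sum_{i=0}^{d}|\lambda_i|>0$; write $\underline{\lambda}=(\lambda_0,\dots,\lambda_d)$. Then \[ \limsup_{n \to \infty}\left|\sum_{i=0}^{d}\lambda_{i}R_{A}(n - i)\right| \ge \limsup_{n \to \infty}\frac{|\sum_{i=0}^{d}\lambda_{i}|}{2(d+1)^{2}}\left(\frac{B(A, \underline{\lambda}, n)}{\sqrt{n}}\right)^{2}. \]
   Context: For a set $A$ of nonnegative integers and an integer $n$, $R_A(n)$ denotes the number of ordered pairs $(a,a')\in A\times A$ with $a+a'=n$ (so $R_A(n)=0$ for $n<0$). $\chi_A$ is the characteristic function of $A$ on the integers ($\chi_A(m)=1$ if $m\in A$, $0$ otherwise; in particular $\chi_A(m)=0$ for $m<0$). For $\underline{\lambda}=(\lambda_0,\dots,\lambda_d)$ define $B(A,\underline{\lambda},n)=\#\{m\in\mathbb{Z}_{\ge 0}: m\le n,\ \sum_{i=0}^{d}\lambda_i\chi_A(m-i)\neq 0\}$. Limsups may equal $+\infty$. -}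

module Defs where

open import Data.Bool using (Bool; true; false; if_then_else_)
open import Data.Nat using (ℕ; zero; suc; _≤_; _<_; _*_; _∸_)
open import Data.Integer using (ℤ; +_; -[1+_]; ∣_∣) renaming (_+_ to _+ℤ_; _*_ to _*ℤ_; _-_ to _-ℤ_)
open import Data.Fin using (Fin; toℕ)
open import Data.Product using (Σ; ∃; _×_)
open import Relation.Binary.PropositionalEquality using (_≡_)
open import Relation.Nullary using (¬_)
open import Data.Rational using (ℚ; _/_) renaming (_<_ to _<ℚ_)

Set⁺ : Set
Set⁺ = ℕ → Bool

Infinite : Set⁺ → Set
Infinite A = ∀ N → ∃ λ a → N ≤ a × A a ≡ true

Σℤ : (k : ℕ) → (Fin k → ℤ) → ℤ
Σℤ zero    f = + 0
Σℤ (suc k) f = f Fin.zero +ℤ Σℤ k (λ i → f (Fin.suc i))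

Σℕ : (k : ℕ) → (Fin k → ℕ) → ℕ
Σℕ zero    f = 0
Σℕ (suc k) f = f Fin.zero Data.Nat.+ Σℕ k (λ i → f (Fin.suc i))

countUpTo : (ℕ → Bool) → ℕ → ℕ
countUpTo P zero    = if P 0 then 1 else 0
countUpTo P (suc n) = (if P (suc n) then 1 else 0) Data.Nat.+ countUpTo P n

χ : Set⁺ → ℤ → ℤ
χ A (+ m)    = if A m then + 1 else + 0
χ A -[1+ _ ] = + 0

_∧_ : Bool → Bool → Bool
true ∧ b = b
false ∧ _ = false

-- R_A(n) for n ∈ ℕ: number of ordered pairs (a, n - a) with a ≤ n, both in A
Rℕ : Set⁺ → ℕ → ℕ
Rℕ A n = countUpTo (λ a → if a Data.Nat.≤ᵇ n then A a ∧ A (n ∸ a) else false) n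

R : Set⁺ → ℤ → ℕ
R A (+ n)    = Rℕ A n
R A -[1+ _ ] = 0

linR : Set⁺ → (d : ℕ) → (Fin (suc d) → ℤ) → ℕ → ℤ
linR A d λs n = Σℤ (suc d) (λ i → λs i *ℤ (+ R A (+ n -ℤ + toℕ i)))

linχ : Set⁺ → (d : ℕ) → (Fin (suc d) → ℤ) → ℕ → ℤ
linχ A d λs m = Σℤ (suc d) (λ i → λs i *ℤ χ A (+ m -ℤ + toℕ i))

nonzeroℤ : ℤ → Bool
nonzeroℤ (+ zero) = false
nonzeroℤ _        = true

B : Set⁺ → (d : ℕ) → (Fin (suc d) → ℤ) → ℕ → ℕ
B A d λs n = countUpTo (λ m → nonzeroℤ (linχ A d λs m)) n

lhsSeq : Set⁺ → (d : ℕ) → (Fin (suc d) → ℤ) → ℕ → ℚ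
lhsSeq A d λs n = (+ ∣ linR A d λs n ∣) / 1

-- the sequence  |Σ λ_i| / (2 (d+1)^2) · (B(A,λ,n)/√n)^2 = |Σ λ_i| B^2 / (2 (d+1)^2 n),
-- defined for n = suc m ≥ 1 (value at n = 0 irrelevant for limsup)
rhsSeq : Set⁺ → (d : ℕ) → (Fin (suc d) → ℤ) → ℕ → ℚ
rhsSeq A d λs zero    = (+ 0) / 1
rhsSeq A d λs (suc m) =
  (+ (∣ Σℤ (suc d) λs ∣ * (B A d λs (suc m) * B A d λs (suc m))))
    / (2 * (suc d * suc d) * suc m)

InfOftenAbove : (ℕ → ℚ) → ℚ → Set
InfOftenAbove x q = ∀ N → ∃ λ n → N ≤ n × q <ℚ x n

-- limsup x ≥ limsup y (in the extended reals), expressed via rational thresholds: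
-- whenever y_n > q infinitely often, then for every q' < q, x_n > q' infinitely often.
LimsupGe : (ℕ → ℚ) → (ℕ → ℚ) → Set
LimsupGe x y = ∀ q → InfOftenAbove y q → ∀ q' → q' <ℚ q → InfOftenAbove x q'

module Submission where

-- Write Q(T) = sumR A T = Σ_{n<T} R_A(n).  Summing Σ λ_i R_A(n - i) over n < T gives Σ λ_i Q(T - i), which differs
-- from (Σ λ_i) Q(T) by at most (Σ |λ_i|)(Q(T) - Q(T - d)).  As Q(T) ≤ T², Q cannot double on each of many
-- consecutive blocks, so a pigeonhole argument finds T slightly above 2N where this increment is a small
-- fraction of Q(T), while Q(T) ≥ Q(2N + 1) ≥ #(A ∩ [0, N])² ≥ B(A, λ, N)² / (d + 1)².  If every
-- |Σ λ_i R_A(n - i)| with n ≥ N₀ were at most a / b, the sum up to T would be about (a / b) T, which is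
-- too small once |Σ λ_i| B(A, λ, N)² / (2 (d + 1)² N) exceeds some c / e > a / b.

open import Defs
open import Data.Nat using (ℕ; zero; suc; _+_; _*_; _∸_; _^_; _≤_; _<_; _≤′_; ≤′-refl; ≤′-step; _≤ᵇ_; _≤?_; _<?_;
                            z≤n; s≤s; s≤s⁻¹; z<s; NonZero; >-nonZero; _/_; _%_)
open import Data.Nat.Properties
open import Data.Nat.DivMod using (m/n*n≤m; m≡m%n+[m/n]*n; m%n<n; /-monoˡ-≤; m*n/n≡m)
open import Data.Nat.Tactic.RingSolver using (solve-∀)
open import Data.Integer using (ℤ; ∣_∣; +_; -[1+_])
import Data.Integer as ℤ
import Data.Integer.Properties as ℤ
open import Algebra.Properties.CommutativeSemigroup +-commutativeSemigroup using (interchange)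
open import Algebra.Properties.CommutativeSemigroup ℤ.+-commutativeSemigroup using ()
  renaming (interchange to ℤ-interchange)
open import Data.Rational using (ℚ; ↥_; ↧_; ↧ₙ_; *<*) renaming (_<_ to _<ℚ_; _/_ to _/ℚ_)
import Data.Rational.Properties as ℚ
open import Data.Rational.Unnormalised using (mkℚᵘ) renaming (*<* to *<*ᵘ)
import Data.Rational.Unnormalised.Properties as ℚᵘ
open import Data.Fin using (Fin; toℕ)
open import Data.Fin.Properties using (toℕ<n)
open import Data.Bool using (Bool; true; false; if_then_else_)
open import Data.Bool.Properties using (T-≡)
open import Data.Product using (∃; _×_; _,_; proj₁; proj₂)
open import Data.Sum using (_⊎_; inj₁; inj₂)
open import Data.Empty using (⊥; ⊥-elim)
open import Function using (_∘_; Equivalence)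
open import Relation.Binary.Core using (_Preserves_⟶_)
open import Relation.Binary.PropositionalEquality
  using (_≡_; refl; sym; trans; cong; cong₂; subst; subst₂; module ≡-Reasoning)
open import Relation.Nullary using (¬_; yes; no)
open import Relation.Nullary.Decidable using (_×-dec_)

sumBelow : (ℕ → ℕ) → ℕ → ℕ
sumBelow f zero    = 0
sumBelow f (suc n) = f n + sumBelow f n

sumBelow-cong : ∀ {f g} n → (∀ {i} → i < n → f i ≡ g i) → sumBelow f n ≡ sumBelow g n
sumBelow-cong zero    f≗g = refl
sumBelow-cong (suc n) f≗g = cong₂ _+_ (f≗g ≤-refl) (sumBelow-cong n (f≗g ∘ m<n⇒m<1+n))

sumBelow-mono : ∀ {f g} n → (∀ {i} → i < n → f i ≤ g i) → sumBelow f n ≤ sumBelow g n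
sumBelow-mono zero    f≤g = z≤n
sumBelow-mono (suc n) f≤g = +-mono-≤ (f≤g ≤-refl) (sumBelow-mono n (f≤g ∘ m<n⇒m<1+n))

sumBelow-monoʳ : ∀ f → sumBelow f Preserves _≤_ ⟶ _≤_
sumBelow-monoʳ f = go ∘ ≤⇒≤′
  where
  go : ∀ {m n} → m ≤′ n → sumBelow f m ≤ sumBelow f n
  go ≤′-refl       = ≤-refl
  go (≤′-step m≤n) = ≤-trans (go m≤n) (m≤n+m _ _)

sumBelow-const : ∀ c n → sumBelow (λ _ → c) n ≡ n * c
sumBelow-const c zero    = refl
sumBelow-const c (suc n) = cong (_+_ c) (sumBelow-const c n)

sumBelow-*ˡ : ∀ c f n → sumBelow (λ i → c * f i) n ≡ c * sumBelow f n
sumBelow-*ˡ c f zero    = sym (*-zeroʳ c)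
sumBelow-*ˡ c f (suc n) = trans (cong (_+_ (c * f n)) (sumBelow-*ˡ c f n)) (sym (*-distribˡ-+ c (f n) _))

sumBelow-*ʳ : ∀ c f n → sumBelow (λ i → f i * c) n ≡ sumBelow f n * c
sumBelow-*ʳ c f n = trans (sumBelow-cong n (λ _ → *-comm _ c)) (trans (sumBelow-*ˡ c f n) (*-comm c _))

sumBelow-+ : ∀ f g n → sumBelow (λ i → f i + g i) n ≡ sumBelow f n + sumBelow g n
sumBelow-+ f g zero    = refl
sumBelow-+ f g (suc n) = trans (cong (_+_ (f n + g n)) (sumBelow-+ f g n)) (interchange (f n) (g n) _ _)

sumBelow-sucˡ : ∀ f n → sumBelow f (suc n) ≡ sumBelow (f ∘ suc) n + f 0
sumBelow-sucˡ f zero    = +-identityʳ (f 0)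
sumBelow-sucˡ f (suc n) = trans (cong (_+_ (f (suc n))) (sumBelow-sucˡ f n)) (sym (+-assoc (f (suc n)) _ _))

sumBelow-telescope : ∀ (g : ℕ → ℕ) → (∀ s → g s ≤ g (suc s)) → ∀ w →
  sumBelow (λ s → g (suc s) ∸ g s) w + g 0 ≡ g w
sumBelow-telescope g g-step zero    = refl
sumBelow-telescope g g-step (suc w) = begin
  (g (suc w) ∸ g w + sumBelow Δg w) + g 0 ≡⟨ +-assoc (g (suc w) ∸ g w) _ _ ⟩
  g (suc w) ∸ g w + (sumBelow Δg w + g 0) ≡⟨ cong (_+_ (g (suc w) ∸ g w)) (sumBelow-telescope g g-step w) ⟩
  g (suc w) ∸ g w + g w                   ≡⟨ m∸n+n≡m (g-step w) ⟩
  g (suc w)                               ∎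
  where
  open ≡-Reasoning
  Δg : ℕ → ℕ
  Δg s = g (suc s) ∸ g s

sumBelow-≤-prefix+tail : ∀ (h : ℕ → ℕ) {a} N0 T → (∀ {n} → N0 ≤ n → n < T → h n ≤ a) →
  sumBelow h T ≤ sumBelow h N0 + T * a
sumBelow-≤-prefix+tail h N0 zero    tail≤a = z≤n
sumBelow-≤-prefix+tail h {a} N0 (suc T) tail≤a with N0 ≤? T
... | no  T<N0 = ≤-trans (sumBelow-monoʳ h (≰⇒> T<N0)) (m≤m+n _ _)
... | yes N0≤T = begin
  h T + sumBelow h T          ≤⟨ +-mono-≤ (tail≤a N0≤T ≤-refl)
                                         (sumBelow-≤-prefix+tail h N0 T (λ N0≤n → tail≤a N0≤n ∘ m<n⇒m<1+n)) ⟩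
  a + (sumBelow h N0 + T * a) ≡⟨ x+[y+z]≡y+[x+z] a (sumBelow h N0) (T * a) ⟩
  sumBelow h N0 + (a + T * a) ∎
  where
  open ≤-Reasoning
  x+[y+z]≡y+[x+z] : ∀ x y z → x + (y + z) ≡ y + (x + z)
  x+[y+z]≡y+[x+z] = solve-∀

Σℕ-mono : ∀ k {f g : Fin k → ℕ} → (∀ i → f i ≤ g i) → Σℕ k f ≤ Σℕ k g
Σℕ-mono zero    f≤g = z≤n
Σℕ-mono (suc k) f≤g = +-mono-≤ (f≤g Fin.zero) (Σℕ-mono k (f≤g ∘ Fin.suc))

Σℕ-const : ∀ k c → Σℕ k (λ _ → c) ≡ k * c
Σℕ-const zero    c = refl
Σℕ-const (suc k) c = cong (_+_ c) (Σℕ-const k c)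

Σℕ-+ : ∀ k (f g : Fin k → ℕ) → Σℕ k (λ i → f i + g i) ≡ Σℕ k f + Σℕ k g
Σℕ-+ zero    f g = refl
Σℕ-+ (suc k) f g = trans (cong (_+_ (f Fin.zero + g Fin.zero)) (Σℕ-+ k (f ∘ Fin.suc) (g ∘ Fin.suc)))
                         (interchange (f Fin.zero) (g Fin.zero) _ _)

Σℕ-*ʳ : ∀ k (f : Fin k → ℕ) x → Σℕ k (λ i → f i * x) ≡ Σℕ k f * x
Σℕ-*ʳ zero    f x = refl
Σℕ-*ʳ (suc k) f x = trans (cong (_+_ (f Fin.zero * x)) (Σℕ-*ʳ k (f ∘ Fin.suc) x))
                          (sym (*-distribʳ-+ x (f Fin.zero) _))

sumBelow-Σℕ : ∀ k (g : ℕ → Fin k → ℕ) n →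
  sumBelow (λ m → Σℕ k (g m)) n ≡ Σℕ k (λ i → sumBelow (λ m → g m i) n)
sumBelow-Σℕ k g zero    = sym (trans (Σℕ-const k 0) (*-zeroʳ k))
sumBelow-Σℕ k g (suc n) = trans (cong (_+_ (Σℕ k (g n))) (sumBelow-Σℕ k g n)) (sym (Σℕ-+ k (g n) _))

Σℤ-cong : ∀ k {f g : Fin k → ℤ} → (∀ i → f i ≡ g i) → Σℤ k f ≡ Σℤ k g
Σℤ-cong zero    f≗g = refl
Σℤ-cong (suc k) f≗g = cong₂ ℤ._+_ (f≗g Fin.zero) (Σℤ-cong k (f≗g ∘ Fin.suc))

Σℤ-+ : ∀ k (f g : Fin k → ℤ) → Σℤ k (λ i → f i ℤ.+ g i) ≡ Σℤ k f ℤ.+ Σℤ k g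
Σℤ-+ zero    f g = refl
Σℤ-+ (suc k) f g = trans (cong (λ z → f Fin.zero ℤ.+ g Fin.zero ℤ.+ z) (Σℤ-+ k (f ∘ Fin.suc) (g ∘ Fin.suc)))
                         (ℤ-interchange (f Fin.zero) (g Fin.zero) _ _)

Σℤ-*ʳ : ∀ k (f : Fin k → ℤ) x → Σℤ k (λ i → f i ℤ.* x) ≡ Σℤ k f ℤ.* x
Σℤ-*ʳ zero    f x = refl
Σℤ-*ʳ (suc k) f x = trans (cong (λ z → f Fin.zero ℤ.* x ℤ.+ z) (Σℤ-*ʳ k (f ∘ Fin.suc) x))
                          (sym (ℤ.*-distribʳ-+ x (f Fin.zero) _))

∣Σℤ∣≤Σℕ∣∣ : ∀ k (f : Fin k → ℤ) → ∣ Σℤ k f ∣ ≤ Σℕ k (λ i → ∣ f i ∣)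
∣Σℤ∣≤Σℕ∣∣ zero    f = z≤n
∣Σℤ∣≤Σℕ∣∣ (suc k) f =
  ≤-trans (ℤ.∣i+j∣≤∣i∣+∣j∣ (f Fin.zero) _) (+-monoʳ-≤ _ (∣Σℤ∣≤Σℕ∣∣ k (f ∘ Fin.suc)))

-- The representation function and its partial sums

indicator : Bool → ℕ
indicator b = if b then 1 else 0

indicator≤1 : ∀ b → indicator b ≤ 1
indicator≤1 true  = ≤-refl
indicator≤1 false = z≤n

countUpTo-sumBelow : ∀ P n → countUpTo P n ≡ sumBelow (indicator ∘ P) (suc n)
countUpTo-sumBelow P zero    = sym (+-identityʳ _)
countUpTo-sumBelow P (suc n) = cong (_+_ (indicator (P (suc n)))) (countUpTo-sumBelow P n)

countUpTo≤1+n : ∀ P n → countUpTo P n ≤ suc n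
countUpTo≤1+n P zero    = indicator≤1 (P 0)
countUpTo≤1+n P (suc n) = +-mono-≤ (indicator≤1 (P (suc n))) (countUpTo≤1+n P n)

sumBelow-convolution : ∀ (f g : ℕ → ℕ) T →
  sumBelow (λ n → sumBelow (λ x → f x * g (n ∸ x)) (suc n)) T ≡ sumBelow (λ x → f x * sumBelow g (T ∸ x)) T
sumBelow-convolution f g zero    = refl
sumBelow-convolution f g (suc T) = begin
  newDiagonal + sumBelow (λ n → sumBelow (λ x → f x * g (n ∸ x)) (suc n)) T
    ≡⟨ cong (_+_ newDiagonal) (sumBelow-convolution f g T) ⟩
  newDiagonal + sumBelow (λ x → f x * sumBelow g (T ∸ x)) T
    ≡⟨ cong (_+_ newDiagonal) (sym lastTermVanishes) ⟩
  newDiagonal + sumBelow (λ x → f x * sumBelow g (T ∸ x)) (suc T)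
    ≡⟨ sym (sumBelow-+ (λ x → f x * g (T ∸ x)) _ (suc T)) ⟩
  sumBelow (λ x → f x * g (T ∸ x) + f x * sumBelow g (T ∸ x)) (suc T)
    ≡⟨ sumBelow-cong (suc T) (λ x<1+T → extend (s≤s⁻¹ x<1+T)) ⟩
  sumBelow (λ x → f x * sumBelow g (suc T ∸ x)) (suc T) ∎
  where
  open ≡-Reasoning
  newDiagonal : ℕ
  newDiagonal = sumBelow (λ x → f x * g (T ∸ x)) (suc T)
  lastTermVanishes :
    sumBelow (λ x → f x * sumBelow g (T ∸ x)) (suc T) ≡ sumBelow (λ x → f x * sumBelow g (T ∸ x)) T
  lastTermVanishes rewrite n∸n≡0 T | *-zeroʳ (f T) = refl
  extend : ∀ {x} → x ≤ T → f x * g (T ∸ x) + f x * sumBelow g (T ∸ x) ≡ f x * sumBelow g (suc T ∸ x)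
  extend {x} x≤T rewrite +-∸-assoc 1 x≤T = sym (*-distribˡ-+ (f x) _ _)

Rℕ-convolution : ∀ A n → Rℕ A n ≡ sumBelow (λ x → indicator (A x) * indicator (A (n ∸ x))) (suc n)
Rℕ-convolution A n = trans (countUpTo-sumBelow _ n) (sumBelow-cong (suc n) (pairIndicator ∘ s≤s⁻¹))
  where
  pairIndicator : ∀ {x} → x ≤ n →
    indicator (if x ≤ᵇ n then A x ∧ A (n ∸ x) else false) ≡ indicator (A x) * indicator (A (n ∸ x))
  pairIndicator {x} x≤n rewrite Equivalence.to T-≡ (≤⇒≤ᵇ x≤n) with A x | A (n ∸ x)
  ... | true  | true  = refl
  ... | true  | false = refl
  ... | false | _     = refl

sumR : Set⁺ → ℕ → ℕ
sumR A = sumBelow (Rℕ A)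

sumR≤square : ∀ A T → sumR A T ≤ T * T
sumR≤square A T = begin
  sumBelow (Rℕ A) T      ≤⟨ sumBelow-mono T (λ {n} n<T → ≤-trans (countUpTo≤1+n _ n) n<T) ⟩
  sumBelow (λ _ → T) T   ≡⟨ sumBelow-const T T ⟩
  T * T                  ∎
  where open ≤-Reasoning

-- Every pair of elements of A up to N has sum below 2N + 1.
countUpTo²≤sumR : ∀ A N → countUpTo A N * countUpTo A N ≤ sumR A (suc N + N)
countUpTo²≤sumR A N rewrite countUpTo-sumBelow A N = begin
  C * C                                   ≡⟨ sym (sumBelow-*ʳ C α (suc N)) ⟩
  sumBelow (λ x → α x * C) (suc N)        ≤⟨ sumBelow-mono (suc N) (*-monoʳ-≤ (α _) ∘ sumBelow-monoʳ α ∘ C-range) ⟩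
  sumBelow pairsFrom (suc N)              ≤⟨ sumBelow-monoʳ pairsFrom (m≤m+n (suc N) N) ⟩
  sumBelow pairsFrom (suc N + N)          ≡⟨ sym (sumBelow-convolution α α (suc N + N)) ⟩
  sumBelow (λ n → sumBelow (λ x → α x * α (n ∸ x)) (suc n)) (suc N + N)
                                          ≡⟨ sumBelow-cong (suc N + N) (λ {n} _ → sym (Rℕ-convolution A n)) ⟩
  sumR A (suc N + N)                      ∎
  where
  open ≤-Reasoning
  α : ℕ → ℕ
  α = indicator ∘ A
  C : ℕ
  C = sumBelow α (suc N)
  pairsFrom : ℕ → ℕ
  pairsFrom x = α x * sumBelow α (suc N + N ∸ x)
  C-range : ∀ {x} → x < suc N → suc N ≤ suc N + N ∸ x
  C-range {x} x<1+N = ≤-trans (≤-reflexive (sym (m+n∸n≡m (suc N) N))) (∸-monoʳ-≤ (suc N + N) (s≤s⁻¹ x<1+N))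

+[1+m]-+[1+n] : ∀ m n → + suc m ℤ.- + suc n ≡ + m ℤ.- + n
+[1+m]-+[1+n] m n = trans (ℤ.[1+m]⊖[1+n]≡m⊖n m n) (sym (ℤ.m-n≡m⊖n m n))

sumR-suc-∸ : ∀ A T i → sumR A (suc T ∸ i) ≡ R A (+ T ℤ.- + i) + sumR A (T ∸ i)
sumR-suc-∸ A T       zero    rewrite +-identityʳ T = refl
sumR-suc-∸ A zero    (suc i) rewrite 0∸n≡0 i = refl
sumR-suc-∸ A (suc T) (suc i) rewrite +[1+m]-+[1+n] T i = sumR-suc-∸ A T i

-- Bounding B(A, λ, N)

sumBelow-shift-≤ : ∀ (g : ℤ → ℕ) → (∀ k → g -[1+ k ] ≡ 0) → ∀ i n →
  sumBelow (λ m → g (+ m ℤ.- + i)) n ≤ sumBelow (λ m → g (+ m)) n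
sumBelow-shift-≤ g g⁻≡0 zero    n       =
  ≤-reflexive (sumBelow-cong n (λ {m} _ → cong (λ k → g (+ k)) (+-identityʳ m)))
sumBelow-shift-≤ g g⁻≡0 (suc i) zero    = z≤n
sumBelow-shift-≤ g g⁻≡0 (suc i) (suc n) = begin
  sumBelow (λ m → g (+ m ℤ.- + suc i)) (suc n)
    ≡⟨ sumBelow-sucˡ _ n ⟩
  sumBelow (λ m → g (+ suc m ℤ.- + suc i)) n + g -[1+ i ]
    ≡⟨ cong₂ _+_ (sumBelow-cong n (λ {m} _ → cong g (+[1+m]-+[1+n] m i))) (g⁻≡0 i) ⟩
  sumBelow (λ m → g (+ m ℤ.- + i)) n + 0
    ≡⟨ +-identityʳ _ ⟩
  sumBelow (λ m → g (+ m ℤ.- + i)) n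
    ≤⟨ sumBelow-shift-≤ g g⁻≡0 i n ⟩
  sumBelow (λ m → g (+ m)) n
    ≤⟨ sumBelow-monoʳ (λ m → g (+ m)) (n≤1+n n) ⟩
  sumBelow (λ m → g (+ m)) (suc n) ∎
  where open ≤-Reasoning

indicator-nonzero-+ : ∀ x y →
  indicator (nonzeroℤ (x ℤ.+ y)) ≤ indicator (nonzeroℤ x) + indicator (nonzeroℤ y)
indicator-nonzero-+ (+ zero)  y rewrite ℤ.+-identityˡ y = ≤-refl
indicator-nonzero-+ (+ suc n) y = ≤-trans (indicator≤1 _) (m≤m+n 1 _)
indicator-nonzero-+ -[1+ n ]  y = ≤-trans (indicator≤1 _) (m≤m+n 1 _)

indicator-nonzero-Σ : ∀ k (f : Fin k → ℤ) →
  indicator (nonzeroℤ (Σℤ k f)) ≤ Σℕ k (λ i → indicator (nonzeroℤ (f i)))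
indicator-nonzero-Σ zero    f = z≤n
indicator-nonzero-Σ (suc k) f =
  ≤-trans (indicator-nonzero-+ (f Fin.zero) _) (+-monoʳ-≤ _ (indicator-nonzero-Σ k (f ∘ Fin.suc)))

indicator-nonzero-*≤∣∣ : ∀ x y → indicator (nonzeroℤ (x ℤ.* y)) ≤ ∣ y ∣
indicator-nonzero-*≤∣∣ x (+ zero) rewrite ℤ.*-zeroʳ x = z≤n
indicator-nonzero-*≤∣∣ x (+ suc n) = ≤-trans (indicator≤1 _) (s≤s z≤n)
indicator-nonzero-*≤∣∣ x -[1+ n ]  = ≤-trans (indicator≤1 _) (s≤s z≤n)

∣χ∣≡indicator : ∀ A m → ∣ χ A (+ m) ∣ ≡ indicator (A m)
∣χ∣≡indicator A m with A m
... | true  = refl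
... | false = refl

-- Σ λ_i χ_A(m - i) ≠ 0 needs some m - i ∈ A, and each element of A arises so from at most d + 1 values of m.
B≤count : ∀ A d λs N → B A d λs N ≤ suc d * countUpTo A N
B≤count A d λs N = begin
  B A d λs N
    ≡⟨ countUpTo-sumBelow _ N ⟩
  sumBelow (λ m → indicator (nonzeroℤ (linχ A d λs m))) (suc N)
    ≤⟨ sumBelow-mono (suc N) (λ {m} _ → nonzero≤Σ∣χ∣ m) ⟩
  sumBelow (λ m → Σℕ (suc d) (λ i → ∣χ∣ (+ m ℤ.- + toℕ i))) (suc N)
    ≡⟨ sumBelow-Σℕ (suc d) (λ m i → ∣χ∣ (+ m ℤ.- + toℕ i)) (suc N) ⟩
  Σℕ (suc d) (λ i → sumBelow (λ m → ∣χ∣ (+ m ℤ.- + toℕ i)) (suc N))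
    ≤⟨ Σℕ-mono (suc d) (λ i → sumBelow-shift-≤ ∣χ∣ (λ _ → refl) (toℕ i) (suc N)) ⟩
  Σℕ (suc d) (λ _ → sumBelow (λ m → ∣χ∣ (+ m)) (suc N))
    ≡⟨ Σℕ-const (suc d) _ ⟩
  suc d * sumBelow (λ m → ∣χ∣ (+ m)) (suc N)
    ≡⟨ cong (suc d *_) (trans (sumBelow-cong (suc N) (λ {m} _ → ∣χ∣≡indicator A m))
                              (sym (countUpTo-sumBelow A N))) ⟩
  suc d * countUpTo A N ∎
  where
  open ≤-Reasoning
  ∣χ∣ : ℤ → ℕ
  ∣χ∣ z = ∣ χ A z ∣
  nonzero≤Σ∣χ∣ : ∀ m → indicator (nonzeroℤ (linχ A d λs m)) ≤ Σℕ (suc d) (λ i → ∣χ∣ (+ m ℤ.- + toℕ i))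
  nonzero≤Σ∣χ∣ m = ≤-trans (indicator-nonzero-Σ (suc d) (λ i → λs i ℤ.* χ A (+ m ℤ.- + toℕ i)))
                           (Σℕ-mono (suc d) (λ i → indicator-nonzero-*≤∣∣ (λs i) (χ A (+ m ℤ.- + toℕ i))))

-- Partial sums of Σ λ_i R_A(n - i)

linQ : Set⁺ → (d : ℕ) → (Fin (suc d) → ℤ) → ℕ → ℤ
linQ A d λs T = Σℤ (suc d) (λ i → λs i ℤ.* + sumR A (T ∸ toℕ i))

linQ-zero : ∀ A d λs → linQ A d λs 0 ≡ + 0
linQ-zero A d λs = begin
  Σℤ (suc d) (λ i → λs i ℤ.* + sumR A (0 ∸ toℕ i))
                                                    ≡⟨ Σℤ-cong (suc d) (λ i → cong (λ n → λs i ℤ.* + sumR A n) (0∸n≡0 (toℕ i))) ⟩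
  Σℤ (suc d) (λ i → λs i ℤ.* + 0)                   ≡⟨ Σℤ-*ʳ (suc d) λs (+ 0) ⟩
  Σℤ (suc d) λs ℤ.* + 0                             ≡⟨ ℤ.*-zeroʳ (Σℤ (suc d) λs) ⟩
  + 0                                               ∎
  where open ≡-Reasoning

linQ-suc : ∀ A d λs T → linQ A d λs (suc T) ≡ linR A d λs T ℤ.+ linQ A d λs T
linQ-suc A d λs T = trans (Σℤ-cong (suc d) split)
  (Σℤ-+ (suc d) (λ i → λs i ℤ.* + R A (+ T ℤ.- + toℕ i)) (λ i → λs i ℤ.* + sumR A (T ∸ toℕ i)))
  where
  split : ∀ i → λs i ℤ.* + sumR A (suc T ∸ toℕ i)
              ≡ λs i ℤ.* + R A (+ T ℤ.- + toℕ i) ℤ.+ λs i ℤ.* + sumR A (T ∸ toℕ i)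
  split i rewrite sumR-suc-∸ A T (toℕ i) | ℤ.pos-+ (R A (+ T ℤ.- + toℕ i)) (sumR A (T ∸ toℕ i)) =
    ℤ.*-distribˡ-+ (λs i) _ _

∣linQ∣≤sum∣linR∣ : ∀ A d λs T → ∣ linQ A d λs T ∣ ≤ sumBelow (λ n → ∣ linR A d λs n ∣) T
∣linQ∣≤sum∣linR∣ A d λs zero    rewrite linQ-zero A d λs = z≤n
∣linQ∣≤sum∣linR∣ A d λs (suc T) rewrite linQ-suc A d λs T =
  ≤-trans (ℤ.∣i+j∣≤∣i∣+∣j∣ (linR A d λs T) _) (+-monoʳ-≤ _ (∣linQ∣≤sum∣linR∣ A d λs T))

∣Σλ∣*U≤∣Σλ*P∣+Σ∣λ∣*Δ : ∀ k (λs : Fin k → ℤ) (P : Fin k → ℕ) {U Δ} →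
  (∀ i → P i ≤ U) → (∀ i → U ∸ P i ≤ Δ) →
  ∣ Σℤ k λs ∣ * U ≤ ∣ Σℤ k (λ i → λs i ℤ.* + P i) ∣ + Σℕ k (λ i → ∣ λs i ∣) * Δ
∣Σλ∣*U≤∣Σλ*P∣+Σ∣λ∣*Δ k λs P {U} {Δ} P≤U U∸P≤Δ = begin
  ∣ Σℤ k λs ∣ * U                                ≡⟨ sym (ℤ.∣i*j∣≡∣i∣*∣j∣ (Σℤ k λs) (+ U)) ⟩
  ∣ Σℤ k λs ℤ.* + U ∣                            ≡⟨ cong ∣_∣ splitU ⟩
  ∣ ΣλP ℤ.+ Σℤ k (λ i → λs i ℤ.* + (U ∸ P i)) ∣  ≤⟨ ℤ.∣i+j∣≤∣i∣+∣j∣ ΣλP _ ⟩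
  ∣ ΣλP ∣ + ∣ Σℤ k (λ i → λs i ℤ.* + (U ∸ P i)) ∣ ≤⟨ +-monoʳ-≤ ∣ ΣλP ∣ (∣Σℤ∣≤Σℕ∣∣ k _) ⟩
  ∣ ΣλP ∣ + Σℕ k (λ i → ∣ λs i ℤ.* + (U ∸ P i) ∣) ≤⟨ +-monoʳ-≤ ∣ ΣλP ∣ (Σℕ-mono k error≤) ⟩
  ∣ ΣλP ∣ + Σℕ k (λ i → ∣ λs i ∣ * Δ)             ≡⟨ cong (_+_ ∣ ΣλP ∣) (Σℕ-*ʳ k (λ i → ∣ λs i ∣) Δ) ⟩
  ∣ ΣλP ∣ + Σℕ k (λ i → ∣ λs i ∣) * Δ             ∎
  where
  open ≤-Reasoning
  ΣλP : ℤ
  ΣλP = Σℤ k (λ i → λs i ℤ.* + P i)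
  splitU : Σℤ k λs ℤ.* + U ≡ ΣλP ℤ.+ Σℤ k (λ i → λs i ℤ.* + (U ∸ P i))
  splitU = trans (sym (Σℤ-*ʳ k λs (+ U))) (trans (Σℤ-cong k splitTerm) (Σℤ-+ k _ _))
    where
    splitTerm : ∀ i → λs i ℤ.* + U ≡ λs i ℤ.* + P i ℤ.+ λs i ℤ.* + (U ∸ P i)
    splitTerm i rewrite sym (ℤ.*-distribˡ-+ (λs i) (+ P i) (+ (U ∸ P i))) | sym (ℤ.pos-+ (P i) (U ∸ P i))
                      | m+[n∸m]≡n (P≤U i) = refl
  error≤ : ∀ i → ∣ λs i ℤ.* + (U ∸ P i) ∣ ≤ ∣ λs i ∣ * Δ
  error≤ i = ≤-trans (≤-reflexive (ℤ.∣i*j∣≡∣i∣*∣j∣ (λs i) _)) (*-monoʳ-≤ ∣ λs i ∣ (U∸P≤Δ i))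

∣Σλ∣*sumR≤∣linQ∣+Σ∣λ∣*increment : ∀ A d λs T →
  ∣ Σℤ (suc d) λs ∣ * sumR A T
    ≤ ∣ linQ A d λs T ∣ + Σℕ (suc d) (λ i → ∣ λs i ∣) * (sumR A T ∸ sumR A (T ∸ d))
∣Σλ∣*sumR≤∣linQ∣+Σ∣λ∣*increment A d λs T =
  ∣Σλ∣*U≤∣Σλ*P∣+Σ∣λ∣*Δ (suc d) λs (λ i → sumR A (T ∸ toℕ i))
    (λ i → sumBelow-monoʳ (Rℕ A) (m∸n≤m T (toℕ i)))
    (λ i → ∸-monoʳ-≤ (sumR A T) (sumBelow-monoʳ (Rℕ A) (∸-monoʳ-≤ T (s≤s⁻¹ (toℕ<n i)))))

-- Slowly growing stretches of monotone sequences

slow-step-or-doubling : ∀ (g : ℕ → ℕ) J → (∃ λ j → j < J × g (suc j) ≤ 2 * g j) ⊎ 2 ^ J * g 0 ≤ g J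
slow-step-or-doubling g zero = inj₂ (≤-reflexive (+-identityʳ (g 0)))
slow-step-or-doubling g (suc J) with slow-step-or-doubling g J
... | inj₁ (j , j<J , slow) = inj₁ (j , m<n⇒m<1+n j<J , slow)
... | inj₂ doubled with g (suc J) ≤? 2 * g J
...   | yes slow = inj₁ (J , ≤-refl , slow)
...   | no fast  = inj₂ (begin
  2 * 2 ^ J * g 0   ≡⟨ *-assoc 2 (2 ^ J) (g 0) ⟩
  2 * (2 ^ J * g 0) ≤⟨ *-monoʳ-≤ 2 doubled ⟩
  2 * g J           ≤⟨ <⇒≤ (≰⇒> fast) ⟩
  g (suc J)         ∎)
  where open ≤-Reasoning

averaging : ∀ (x : ℕ → ℕ) {w Y} → 0 < w → sumBelow x w ≤ Y → ∃ λ s → s < w × w * x s ≤ Y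
averaging x {w} {Y} 0<w Σx≤Y with anyUpTo? (λ s → w * x s ≤? Y) w
... | yes found = found
... | no  none  = ⊥-elim (<⇒≱ (*-monoʳ-< w {{>-nonZero 0<w}} ≤-refl) (begin
  w * suc Y                  ≡⟨ sym (sumBelow-const (suc Y) w) ⟩
  sumBelow (λ _ → suc Y) w   ≤⟨ sumBelow-mono w (λ {s} s<w → ≰⇒> (λ small → none (s , s<w , small))) ⟩
  sumBelow (λ s → w * x s) w ≡⟨ sumBelow-*ˡ w x w ⟩
  w * sumBelow x w           ≤⟨ *-monoʳ-≤ w Σx≤Y ⟩
  w * Y                      ∎))
  where open ≤-Reasoning

-- Pigeonhole over the w steps of length d into which the block splits.
small-step-in-slow-block : ∀ {f} → f Preserves _≤_ ⟶ _≤_ → ∀ K d w → 0 < w → f (K + w * d) ≤ 2 * f K →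
  ∃ λ T → K ≤ T × T ≤ K + w * d × w * (f T ∸ f (T ∸ d)) ≤ 2 * f T
small-step-in-slow-block {f} f-mono K d w 0<w slow with averaging (λ s → g (suc s) ∸ g s) 0<w Σsteps≤
  where
  g : ℕ → ℕ
  g s = f (K + s * d)
  Σsteps≤ : sumBelow (λ s → g (suc s) ∸ g s) w ≤ 2 * f K
  Σsteps≤ = begin
    sumBelow (λ s → g (suc s) ∸ g s) w       ≤⟨ m≤m+n _ (g 0) ⟩
    sumBelow (λ s → g (suc s) ∸ g s) w + g 0 ≡⟨ sumBelow-telescope g (λ s → f-mono (+-monoʳ-≤ K (m≤n+m _ d))) w ⟩
    f (K + w * d)                            ≤⟨ slow ⟩
    2 * f K                                  ∎
    where open ≤-Reasoning
... | s , s<w , small = K + suc s * d , m≤m+n K _ , +-monoʳ-≤ K (*-monoˡ-≤ d s<w) , (begin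
  w * (f (K + suc s * d) ∸ f (K + suc s * d ∸ d)) ≡⟨ cong (λ t → w * (f (K + suc s * d) ∸ f t)) previous ⟩
  w * (f (K + suc s * d) ∸ f (K + s * d))         ≤⟨ small ⟩
  2 * f K                                         ≤⟨ *-monoʳ-≤ 2 (f-mono (m≤m+n K _)) ⟩
  2 * f (K + suc s * d)                           ∎)
  where
  open ≤-Reasoning
  previous : K + suc s * d ∸ d ≡ K + s * d
  previous rewrite +-comm d (s * d) | sym (+-assoc K (s * d) d) = m+n∸n≡m (K + s * d) d

blockEnd : ∀ T0 j V → T0 + j * V + V ≡ T0 + suc j * V
blockEnd T0 j V = trans (+-assoc T0 (j * V) V) (cong (_+_ T0) (+-comm (j * V) V))

-- Were f to double on each of J consecutive blocks, it would reach 2^J.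
point-of-slow-growth : ∀ {f} → f Preserves _≤_ ⟶ _≤_ → ∀ T0 d w V J → 0 < w → w * d ≤ V →
  1 ≤ f T0 → f (T0 + J * V) < 2 ^ J →
  ∃ λ T → T0 ≤ T × T ≤ T0 + J * V × w * (f T ∸ f (T ∸ d)) ≤ 2 * f T
point-of-slow-growth {f} f-mono T0 d w V J 0<w wd≤V 1≤fT0 fJ<2^J
  with slow-step-or-doubling (λ j → f (T0 + j * V)) J
... | inj₂ doubled = ⊥-elim (<⇒≱ fJ<2^J (begin
  2 ^ J                    ≡⟨ sym (*-identityʳ (2 ^ J)) ⟩
  2 ^ J * 1                ≤⟨ *-monoʳ-≤ (2 ^ J) (subst (λ t → 1 ≤ f t) (sym (+-identityʳ T0)) 1≤fT0) ⟩
  2 ^ J * f (T0 + 0 * V)   ≤⟨ doubled ⟩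
  f (T0 + J * V)           ∎))
  where open ≤-Reasoning
... | inj₁ (j , j<J , slow) with small-step-in-slow-block f-mono (T0 + j * V) d w 0<w slow′
  where
  slow′ : f (T0 + j * V + w * d) ≤ 2 * f (T0 + j * V)
  slow′ = ≤-trans (f-mono (≤-trans (+-monoʳ-≤ (T0 + j * V) wd≤V) (≤-reflexive (blockEnd T0 j V)))) slow
... | T , start≤T , T≤end , small = T , ≤-trans (m≤m+n T0 _) start≤T , T≤T0+JV , small
  where
  open ≤-Reasoning
  T≤T0+JV : T ≤ T0 + J * V
  T≤T0+JV = begin
    T                        ≤⟨ T≤end ⟩
    T0 + j * V + w * d       ≤⟨ +-monoʳ-≤ (T0 + j * V) wd≤V ⟩
    T0 + j * V + V           ≡⟨ blockEnd T0 j V ⟩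
    T0 + suc j * V           ≤⟨ +-monoʳ-≤ T0 (*-monoˡ-≤ V j<J) ⟩
    T0 + J * V               ∎

cube≤2^ : ∀ k → (12 + k) * ((12 + k) * (12 + k)) ≤ 2 ^ (11 + k)
cube≤2^ zero    = ≤ᵇ⇒≤ 1728 2048 _
cube≤2^ (suc k) = begin
  (13 + k) * ((13 + k) * (13 + k))
    ≤⟨ m≤m+n _ _ ⟩
  (13 + k) * ((13 + k) * (13 + k)) + (k * (k * k) + 33 * (k * k) + 357 * k + 1259)
    ≡⟨ cubeStep k ⟩
  2 * ((12 + k) * ((12 + k) * (12 + k)))
    ≤⟨ *-monoʳ-≤ 2 (cube≤2^ k) ⟩
  2 * 2 ^ (11 + k)
    ≡⟨ cong (2 ^_) (sym (+-suc 11 k)) ⟩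
  2 ^ (11 + suc k) ∎
  where
  open ≤-Reasoning
  cubeStep : ∀ k → (13 + k) * ((13 + k) * (13 + k)) + (k * (k * k) + 33 * (k * k) + 357 * k + 1259)
                 ≡ 2 * ((12 + k) * ((12 + k) * (12 + k)))
  cubeStep = solve-∀

poly<exp : ∀ K J → 11 + K ≤ J → K * (suc J * suc J) < 2 ^ J
poly<exp K J 11+K≤J = begin-strict
  K * (suc J * suc J)              <⟨ *-monoˡ-< (suc J * suc J) (s≤s (≤-trans (m≤n+m K 11) 11+K≤J)) ⟩
  suc J * (suc J * suc J)          ≡⟨ cong (λ t → suc t * (suc t * suc t)) J≡11+k ⟩
  (12 + k) * ((12 + k) * (12 + k)) ≤⟨ cube≤2^ k ⟩
  2 ^ (11 + k)                     ≡⟨ cong (2 ^_) (sym J≡11+k) ⟩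
  2 ^ J                            ∎
  where
  open ≤-Reasoning
  k : ℕ
  k = J ∸ 11
  J≡11+k : J ≡ 11 + k
  J≡11+k = sym (m+[n∸m]≡n (≤-trans (m≤m+n 11 K) 11+K≤J))

m*n>0⇒m>0×n>0 : ∀ m n → 0 < m * n → 0 < m × 0 < n
m*n>0⇒m>0×n>0 (suc m) (suc n) _ = z<s , z<s
m*n>0⇒m>0×n>0 (suc m) zero    mn>0 = ⊥-elim (<-irrefl (sym (*-zeroʳ (suc m))) mn>0)

absorb-error : ∀ {Λ U s E t} → 1 ≤ Λ → Λ * U ≤ s + E → suc t * E ≤ U → t * (Λ * U) ≤ suc t * s
absorb-error {Λ} {U} {s} {E} {t} 1≤Λ ΛU≤s+E tE≤U = +-cancelʳ-≤ (Λ * U) (t * (Λ * U)) (suc t * s) (begin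
  t * (Λ * U) + Λ * U    ≡⟨ +-comm (t * (Λ * U)) (Λ * U) ⟩
  suc t * (Λ * U)        ≤⟨ *-monoʳ-≤ (suc t) ΛU≤s+E ⟩
  suc t * (s + E)        ≡⟨ *-distribˡ-+ (suc t) s E ⟩
  suc t * s + suc t * E  ≤⟨ +-monoʳ-≤ (suc t * s) tE≤U ⟩
  suc t * s + U          ≤⟨ +-monoʳ-≤ (suc t * s) (m≤n*m U Λ {{>-nonZero 1≤Λ}}) ⟩
  suc t * s + Λ * U      ∎)
  where open ≤-Reasoning

budget-contradiction : ∀ {x y E N T} → x < y → 2 * E ≤ N → suc N + N ≤ T → y * T ≤ 2 * y * N + N →
  4 * y * (2 * y * N + 1) ≤ suc (4 * y) * (E + x * T) → ⊥
budget-contradiction {x} {y} {E} {N} {T} x<y 2E≤N T₀≤T yT≤ budget = m+1+n≰m total (begin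
  total + suc (N + 16 * y + 1)                    ≡⟨ doubledLhs y N ⟩
  2 * (4 * y * (2 * y * N + 1) + t * (suc N + N)) ≤⟨ *-monoʳ-≤ 2 lhs≤rhs ⟩
  2 * (t * E + t * (2 * y * N + N))               ≡⟨ doubledRhs t E (2 * y * N + N) ⟩
  t * (2 * E) + 2 * (t * (2 * y * N + N))         ≤⟨ +-monoˡ-≤ _ (*-monoʳ-≤ t 2E≤N) ⟩
  total                                           ∎)
  where
  open ≤-Reasoning
  t total : ℕ
  t = suc (4 * y)
  total = t * N + 2 * (t * (2 * y * N + N))
  lhs≤rhs : 4 * y * (2 * y * N + 1) + t * (suc N + N) ≤ t * E + t * (2 * y * N + N)
  lhs≤rhs = begin
    4 * y * (2 * y * N + 1) + t * (suc N + N) ≤⟨ +-mono-≤ budget (*-monoʳ-≤ t T₀≤T) ⟩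
    t * (E + x * T) + t * T                   ≡⟨ regroup t E x T ⟩
    t * E + t * (suc x * T)                   ≤⟨ +-monoʳ-≤ (t * E) (*-monoʳ-≤ t (≤-trans (*-monoˡ-≤ T x<y) yT≤)) ⟩
    t * E + t * (2 * y * N + N)               ∎
    where
    regroup : ∀ t E x T → t * (E + x * T) + t * T ≡ t * E + t * (suc x * T)
    regroup = solve-∀
  doubledLhs : ∀ y N → suc (4 * y) * N + 2 * (suc (4 * y) * (2 * y * N + N)) + suc (N + 16 * y + 1)
                     ≡ 2 * (4 * y * (2 * y * N + 1) + suc (4 * y) * (suc N + N))
  doubledLhs = solve-∀
  doubledRhs : ∀ t E M → 2 * (t * E + t * M) ≡ t * (2 * E) + 2 * (t * M)
  doubledRhs = solve-∀

drop-</ : ∀ (q : ℚ) x n .{{_ : NonZero n}} → q <ℚ x /ℚ n → ↥ q ℤ.* + n ℤ.< x ℤ.* ↧ q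
drop-</ q@record{} x (suc k) q<x/n
  with ℚᵘ.<-respʳ-≃ (ℚ.toℚᵘ-fromℚᵘ (mkℚᵘ x k)) (ℚ.toℚᵘ-mono-< q<x/n)
... | *<*ᵘ lt = lt

lift-</ : ∀ (q : ℚ) x n .{{_ : NonZero n}} → ↥ q ℤ.* + n ℤ.< x ℤ.* ↧ q → q <ℚ x /ℚ n
lift-</ q@record{} x (suc k) lt =
  ℚ.toℚᵘ-cancel-< (ℚᵘ.<-respʳ-≃ (ℚᵘ.≃-sym (ℚ.toℚᵘ-fromℚᵘ (mkℚᵘ x k))) (*<*ᵘ lt))

pos-*-< : ∀ m n o p → + m ℤ.* + n ℤ.< + o ℤ.* + p → m * n < o * p
pos-*-< m n o p lt = ℤ.drop‿+<+ (subst₂ ℤ._<_ (sym (ℤ.pos-* m n)) (sym (ℤ.pos-* o p)) lt)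

nonNegative-< : ∀ {q′ q : ℚ} {a} → ↥ q′ ≡ + a → q′ <ℚ q →
  ∃ λ c → ↥ q ≡ + c × a * ↧ₙ q < c * ↧ₙ q′
nonNegative-< {q′} {q} {a} ↥q′≡a (*<* lt) with ↥ q in ↥q≡
... | + c      = c , refl , pos-*-< a (↧ₙ q) c (↧ₙ q′) (subst (λ x → x ℤ.* ↧ q ℤ.< + c ℤ.* ↧ q′) ↥q′≡a lt)
... | -[1+ k ] = ⊥-elim (nonNeg≮neg (subst (λ x → x ℤ.* ↧ q ℤ.< -[1+ k ] ℤ.* ↧ q′) ↥q′≡a lt))
  where
  nonNeg≮neg : ¬ (+ a ℤ.* ↧ q ℤ.< -[1+ k ] ℤ.* ↧ q′)
  nonNeg≮neg rewrite sym (ℤ.pos-* a (↧ₙ q)) = λ ()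

below-/⇒ : ∀ {q c} x n .{{_ : NonZero n}} → ↥ q ≡ + c → q <ℚ + x /ℚ n → c * n < x * ↧ₙ q
below-/⇒ {q} {c} x n ↥q≡c q<x/n =
  pos-*-< c n x (↧ₙ q) (subst (λ y → y ℤ.* + n ℤ.< + x ℤ.* ↧ q) ↥q≡c (drop-</ q (+ x) n q<x/n))

below-/⇐ : ∀ {q a} x n .{{_ : NonZero n}} → ↥ q ≡ + a → a * n < x * ↧ₙ q → q <ℚ + x /ℚ n
below-/⇐ {q} {a} x n ↥q≡a an<xb = lift-</ q (+ x) n
  (subst₂ ℤ._<_ (trans (ℤ.pos-* a n) (cong (ℤ._* + n) (sym ↥q≡a))) (ℤ.pos-* x (↧ₙ q)) (ℤ.+<+ an<xb))

negative-below-/ : ∀ {q k} x n .{{_ : NonZero n}} → ↥ q ≡ -[1+ k ] → q <ℚ + x /ℚ n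
negative-below-/ {q} x (suc n) ↥q≡ = lift-</ q (+ x) (suc n)
  (subst₂ ℤ._<_ (cong (ℤ._* + suc n) (sym ↥q≡)) (ℤ.pos-* x (↧ₙ q)) ℤ.-<+)

module Witness (A : Set⁺) (d : ℕ) (λs : Fin (suc d) → ℤ) (L>0 : 0 < Σℕ (suc d) (λ i → ∣ λs i ∣))
               (a b c e : ℕ) (b>0 : 0 < b) (ae<cb : a * e < c * b) (N0 : ℕ) where

  -- With y = cb and w = 2 (4y + 1) L, the increment term at a point found by point-of-slow-growth costs at
  -- most a 1 / (4y + 1) share of Λ Q(T).  With J = N / G blocks of length V the point T stays below
  -- 2N + 1 + JV, short enough for yT ≤ 2yN + N, and threshold makes J large enough for 2^J to beat Q.
  Λ L D y w V G K D0 : ℕ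
  Λ = ∣ Σℤ (suc d) λs ∣
  L = Σℕ (suc d) (λ i → ∣ λs i ∣)
  D = suc d
  y = c * b
  w = 2 * (suc (4 * y) * L)
  V = suc (w * d)
  G = 2 * y * V
  K = 3 * G * (3 * G)
  D0 = sumBelow (λ n → b * ∣ linR A d λs n ∣) N0

  threshold : ℕ
  threshold = 2 * (e * D0) + 2 * y + G * (11 + K)

  y>0 : 0 < y
  y>0 = ≤-trans (s≤s z≤n) ae<cb

  2y>0 : 0 < 2 * y
  2y>0 = *-mono-≤ (s≤s {0} {1} z≤n) y>0

  G>0 : 0 < G
  G>0 = *-mono-≤ 2y>0 (s≤s {0} {w * d} z≤n)

  B²-dominates : ∀ {N U} → countUpTo A N * countUpTo A N ≤ U →
    c * (2 * (D * D) * N) < Λ * (B A d λs N * B A d λs N) * e → 2 * c * N < e * (Λ * U)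
  B²-dominates {N} {U} C²≤U rhs-large = *-cancelˡ-< (D * D) _ _ (begin-strict
    D * D * (2 * c * N)              ≡⟨ rearrange₁ D c N ⟩
    c * (2 * (D * D) * N)            <⟨ rhs-large ⟩
    Λ * (Bₙ * Bₙ) * e                ≤⟨ *-monoˡ-≤ e (*-monoʳ-≤ Λ (*-mono-≤ Bₙ≤DC Bₙ≤DC)) ⟩
    Λ * ((D * C) * (D * C)) * e      ≡⟨ rearrange₂ Λ D C e ⟩
    D * D * (e * (Λ * (C * C)))      ≤⟨ *-monoʳ-≤ (D * D) (*-monoʳ-≤ e (*-monoʳ-≤ Λ C²≤U)) ⟩
    D * D * (e * (Λ * U))            ∎)
    where
    open ≤-Reasoning
    Bₙ C : ℕ
    Bₙ = B A d λs N
    C = countUpTo A N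
    Bₙ≤DC : Bₙ ≤ D * C
    Bₙ≤DC = B≤count A d λs N
    rearrange₁ : ∀ D c N → D * D * (2 * c * N) ≡ c * (2 * (D * D) * N)
    rearrange₁ = solve-∀
    rearrange₂ : ∀ Λ D C e → Λ * ((D * C) * (D * C)) * e ≡ D * D * (e * (Λ * (C * C)))
    rearrange₂ = solve-∀

  2eD0≤N : ∀ {N} → threshold < N → 2 * (e * D0) ≤ N
  2eD0≤N threshold<N = ≤-trans (≤-trans (m≤m+n _ _) (m≤m+n _ _)) (<⇒≤ threshold<N)

  2y≤N : ∀ {N} → threshold < N → 2 * y ≤ N
  2y≤N threshold<N = ≤-trans (≤-trans (m≤n+m _ (2 * (e * D0))) (m≤m+n _ _)) (<⇒≤ threshold<N)

  G[11+K]≤N : ∀ {N} → threshold < N → G * (11 + K) ≤ N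
  G[11+K]≤N threshold<N = ≤-trans (m≤n+m _ _) (<⇒≤ threshold<N)

  instance
    G≢0 : NonZero G
    G≢0 = >-nonZero G>0

  slow-point : ∀ N → threshold < N → 1 ≤ sumR A (suc N + N) →
    ∃ λ T → suc N + N ≤ T × y * T ≤ 2 * y * N + N × w * (sumR A T ∸ sumR A (T ∸ d)) ≤ 2 * sumR A T
  slow-point N threshold<N 1≤sumR =
    let T , T₀≤T , T≤T₀+JV , small =
          point-of-slow-growth (sumBelow-monoʳ (Rℕ A)) (suc N + N) d w V J w>0 (n≤1+n _) 1≤sumR sumR<2^J
    in  T , T₀≤T , yT≤ T≤T₀+JV , small
    where
    open ≤-Reasoning
    J : ℕ
    J = N / G
    JG≤N : J * G ≤ N
    JG≤N = m/n*n≤m N G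
    N<[1+J]G : N < suc J * G
    N<[1+J]G = begin-strict
      N             ≡⟨ m≡m%n+[m/n]*n N G ⟩
      N % G + J * G <⟨ +-monoˡ-< (J * G) (m%n<n N G) ⟩
      G + J * G     ∎
    JV≤N : J * V ≤ N
    JV≤N = ≤-trans (*-monoʳ-≤ J (m≤n*m V (2 * y) {{>-nonZero 2y>0}})) JG≤N
    w>0 : 0 < w
    w>0 = *-mono-≤ (s≤s {0} {1} z≤n) (≤-trans L>0 (m≤m+n L (4 * y * L)))
    11+K≤J : 11 + K ≤ J
    11+K≤J = ≤-trans (≤-reflexive (sym (m*n/n≡m (11 + K) G)))
                     (/-monoˡ-≤ G (≤-trans (≤-reflexive (*-comm (11 + K) G)) (G[11+K]≤N threshold<N)))
    sumR<2^J : sumR A (suc N + N + J * V) < 2 ^ J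
    sumR<2^J = begin-strict
      sumR A X                            ≤⟨ sumR≤square A X ⟩
      X * X                               ≤⟨ *-mono-≤ X≤ X≤ ⟩
      3 * (suc J * G) * (3 * (suc J * G)) ≡⟨ rearrange J G ⟩
      K * (suc J * suc J)                 <⟨ poly<exp K J 11+K≤J ⟩
      2 ^ J                               ∎
      where
      X : ℕ
      X = suc N + N + J * V
      X≤ : X ≤ 3 * (suc J * G)
      X≤ = begin
        suc N + N + J * V ≤⟨ +-monoʳ-≤ (suc N + N) JV≤N ⟩
        suc N + N + N     ≤⟨ m≤m+n _ 2 ⟩
        suc N + N + N + 2 ≡⟨ threeTimes N ⟩
        3 * suc N         ≤⟨ *-monoʳ-≤ 3 N<[1+J]G ⟩
        3 * (suc J * G)   ∎
        where
        threeTimes : ∀ N → suc N + N + N + 2 ≡ 3 * suc N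
        threeTimes = solve-∀
      rearrange : ∀ J G → 3 * (suc J * G) * (3 * (suc J * G)) ≡ 3 * G * (3 * G) * (suc J * suc J)
      rearrange = solve-∀
    yT≤ : ∀ {T} → T ≤ suc N + N + J * V → y * T ≤ 2 * y * N + N
    yT≤ {T} T≤ = begin
      y * T                          ≤⟨ *-monoʳ-≤ y T≤ ⟩
      y * (suc N + N + J * V)        ≡⟨ expand y N J V ⟩
      2 * y * N + (y + y * (J * V))  ≤⟨ +-monoʳ-≤ (2 * y * N) (*-cancelˡ-≤ 2 (begin
        2 * (y + y * (J * V))          ≡⟨ double y J V ⟩
        2 * y + J * G                  ≤⟨ +-mono-≤ (2y≤N threshold<N) JG≤N ⟩
        N + N                          ≡⟨ cong (_+_ N) (sym (+-identityʳ N)) ⟩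
        2 * N                          ∎)) ⟩
      2 * y * N + N                  ∎
      where
      expand : ∀ y N J V → y * (suc N + N + J * V) ≡ 2 * y * N + (y + y * (J * V))
      expand = solve-∀
      double : ∀ y J V → 2 * (y + y * (J * V)) ≡ 2 * y + J * (2 * y * V)
      double = solve-∀

  silence-impossible : ∀ {N T} → threshold < N → suc N + N ≤ T → y * T ≤ 2 * y * N + N →
    w * (sumR A T ∸ sumR A (T ∸ d)) ≤ 2 * sumR A T → 2 * c * N < e * (Λ * sumR A T) →
    ¬ (∀ {n} → N0 ≤ n → n < T → b * ∣ linR A d λs n ∣ ≤ a)
  silence-impossible {N} {T} threshold<N T₀≤T yT≤ small dominant silent =
    budget-contradiction ae<cb (2eD0≤N threshold<N) T₀≤T yT≤ (begin
      4 * y * (2 * y * N + 1)           ≤⟨ *-monoʳ-≤ (4 * y) (begin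
        2 * (c * b) * N + 1               ≤⟨ +-monoʳ-≤ _ b>0 ⟩
        2 * (c * b) * N + b               ≡⟨ factor-b b c N ⟩
        b * suc (2 * c * N)               ≤⟨ *-monoʳ-≤ b dominant ⟩
        b * (e * (Λ * U))                 ∎) ⟩
      4 * y * (b * (e * (Λ * U)))       ≡⟨ regroup₁ (4 * y) b e (Λ * U) ⟩
      e * b * (4 * y * (Λ * U))         ≤⟨ *-monoʳ-≤ (e * b) (absorb-error {t = 4 * y} 1≤Λ ΛU≤s+LΔ tLΔ≤U) ⟩
      e * b * (suc (4 * y) * s)         ≡⟨ regroup₂ e b (suc (4 * y)) s ⟩
      suc (4 * y) * (e * (b * s))       ≤⟨ *-monoʳ-≤ (suc (4 * y)) (*-monoʳ-≤ e bs≤D0+Ta) ⟩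
      suc (4 * y) * (e * (D0 + T * a))  ≡⟨ cong (suc (4 * y) *_) (regroup₃ e D0 T a) ⟩
      suc (4 * y) * (e * D0 + a * e * T) ∎)
    where
    open ≤-Reasoning
    U Δ s : ℕ
    U = sumR A T
    Δ = U ∸ sumR A (T ∸ d)
    s = sumBelow (λ n → ∣ linR A d λs n ∣) T
    1≤Λ : 1 ≤ Λ
    1≤Λ = proj₁ (m*n>0⇒m>0×n>0 Λ U (proj₂ (m*n>0⇒m>0×n>0 e (Λ * U) (≤-trans (s≤s z≤n) dominant))))
    ΛU≤s+LΔ : Λ * U ≤ s + L * Δ
    ΛU≤s+LΔ = ≤-trans (∣Σλ∣*sumR≤∣linQ∣+Σ∣λ∣*increment A d λs T)
                      (+-monoˡ-≤ (L * Δ) (∣linQ∣≤sum∣linR∣ A d λs T))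
    tLΔ≤U : suc (4 * y) * (L * Δ) ≤ U
    tLΔ≤U = *-cancelˡ-≤ 2 (≤-trans (≤-reflexive (regroup 2 (suc (4 * y)) L Δ)) small)
      where
      regroup : ∀ k t L Δ → k * (t * (L * Δ)) ≡ k * (t * L) * Δ
      regroup = solve-∀
    bs≤D0+Ta : b * s ≤ D0 + T * a
    bs≤D0+Ta = ≤-trans (≤-reflexive (sym (sumBelow-*ˡ b _ T)))
                       (sumBelow-≤-prefix+tail (λ n → b * ∣ linR A d λs n ∣) N0 T silent)
    factor-b : ∀ b c N → 2 * (c * b) * N + b ≡ b * suc (2 * c * N)
    factor-b = solve-∀
    regroup₁ : ∀ f b e x → f * (b * (e * x)) ≡ e * b * (f * x)
    regroup₁ = solve-∀
    regroup₂ : ∀ e b t s → e * b * (t * s) ≡ t * (e * (b * s))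
    regroup₂ = solve-∀
    regroup₃ : ∀ e D0 T a → e * (D0 + T * a) ≡ e * D0 + a * e * T
    regroup₃ = solve-∀

  witness : ∀ N → threshold < N → c * (2 * (D * D) * N) < Λ * (B A d λs N * B A d λs N) * e →
    ∃ λ n → N0 ≤ n × a < b * ∣ linR A d λs n ∣
  witness N threshold<N rhs-large = search (slow-point N threshold<N 1≤U₀)
    where
    U₀>0 : 0 < e * (Λ * sumR A (suc N + N))
    U₀>0 = ≤-trans (s≤s z≤n) (B²-dominates (countUpTo²≤sumR A N) rhs-large)
    1≤U₀ : 1 ≤ sumR A (suc N + N)
    1≤U₀ = proj₂ (m*n>0⇒m>0×n>0 Λ _ (proj₂ (m*n>0⇒m>0×n>0 e _ U₀>0)))
    search : (∃ λ T → suc N + N ≤ T × y * T ≤ 2 * y * N + N ×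
                        w * (sumR A T ∸ sumR A (T ∸ d)) ≤ 2 * sumR A T) →
      ∃ λ n → N0 ≤ n × a < b * ∣ linR A d λs n ∣
    search (T , T₀≤T , yT≤ , small) with anyUpTo? (λ n → (N0 ≤? n) ×-dec (a <? b * ∣ linR A d λs n ∣)) T
    ... | yes (n , _ , found) = n , found
    ... | no  none = ⊥-elim (silence-impossible threshold<N T₀≤T yT≤ small
                      (B²-dominates (≤-trans (countUpTo²≤sumR A N) (sumBelow-monoʳ (Rℕ A) T₀≤T)) rhs-large)
                      (λ {n} N0≤n n<T → ≮⇒≥ (λ loud → none (n , n<T , N0≤n , loud))))

  witness-often : ∀ {q} → ↥ q ≡ + c → ↧ₙ q ≡ e → InfOftenAbove (rhsSeq A d λs) q →
    ∃ λ n → N0 ≤ n × a < b * ∣ linR A d λs n ∣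
  witness-often {q} ↥q≡c ↧q≡e often with often (suc threshold)
  ... | zero  , ()          , _
  ... | suc m , threshold<N , q<rhs =
    witness N threshold<N (subst (λ e′ → c * (2 * (D * D) * N) < Λ * (Bₙ * Bₙ) * e′) ↧q≡e
                                 (below-/⇒ (Λ * (Bₙ * Bₙ)) (2 * (D * D) * N) ↥q≡c q<rhs))
    where
    N Bₙ : ℕ
    N = suc m
    Bₙ = B A d λs N

theorem1 : (A : Set⁺) → Infinite A → (d : ℕ) → (λs : Fin (suc d) → ℤ)
    → 0 < Σℕ (suc d) (λ i → ∣ λs i ∣)
    → LimsupGe (lhsSeq A d λs) (rhsSeq A d λs)
theorem1 A _ d λs L>0 q q-often q′ q′<q N0 with ↥ q′ in ↥q′≡
... | -[1+ _ ] = N0 , ≤-refl , negative-below-/ ∣ linR A d λs N0 ∣ 1 ↥q′≡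
... | + a =
  let c , ↥q≡c , ae<cb = nonNegative-< ↥q′≡ q′<q
      open Witness A d λs L>0 a (↧ₙ q′) c (↧ₙ q) z<s ae<cb N0
      n , N0≤n , loud = witness-often ↥q≡c refl q-often
  in  n , N0≤n , below-/⇐ ∣ linR A d λs n ∣ 1 ↥q′≡
                   (subst₂ _<_ (sym (*-identityʳ a)) (*-comm (↧ₙ q′) _) loud)
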